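{- For $r\ge0$ let $u_r(n)$ be the number of permutations of $[n]$ containing exactly $r$ occurrences of the pattern $12\text{ - }3$, and $U_r(x)=\sum_{n\ge0}u_r(n)x^n$. Then, as formal power series, $$U_1(x)=\frac{x}{1-x}\left(U_1\Bigl(\frac{x}{1-x}\Bigr)+U_0\Bigl(\frac{x}{1-x}\Bigr)-U_0(x)\right).$$
   Context: An occurrence of the pattern $12\text{ - }3$ in a permutation $a_1a_2\cdots a_n$ is a pair of indices $(i,j)$ with $i+1<j\le n$ such that $a_i<a_{i+1}<a_j$. The empty permutation has no occurrences, so $u_0(0)=1$. -}

module Defs where

open import Data.Nat using (ℕ; zero; suc; _∸_) renaming (_+_ to _+ℕ_)
open import Relation.Nullary using (yes; no)
open import Data.Fin as Fin using (Fin)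
open import Data.Fin.Properties using (_<?_)
open import Data.Vec using (Vec; []; _∷_; toList)
open import Data.List using (List; []; _∷_; [_]; length; filter; map; concatMap; allFin)
import Data.Nat.Properties as ℕₚ
open import Data.Integer using (ℤ; +_; _+_; _-_; _*_)
import Data.List.Relation.Unary.Unique.DecPropositional as UniqueDec

allWords : ∀ {n} (m : ℕ) → List (Vec (Fin n) m)
allWords {n} zero    = [ [] ]
allWords {n} (suc m) = concatMap (λ i → map (i ∷_) (allWords m)) (allFin n)

module UniqueFin (n : ℕ) = UniqueDec (Fin._≟_ {n})

-- A permutation of [n] (one-line notation a₁…aₙ, values in Fin n ≅ [n])
-- is a word of length n over Fin n with pairwise distinct entries.
-- `perms n` lists every permutation of [n] exactly once.
perms : (n : ℕ) → List (Vec (Fin n) n)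
perms n = filter (λ v → UniqueFin.unique? n (toList v)) (allWords n)

-- Number of occurrences of 12-3 in a word a₁a₂⋯aₙ: pairs (i , j) with
-- i + 1 < j ≤ n and aᵢ < aᵢ₊₁ < aⱼ.  For the word x ∷ y ∷ rest the pairs
-- with i = 1 are the entries z of rest with x < y < z; the remaining
-- pairs are the occurrences in y ∷ rest.
-- occFirst x w = number of occurrences (1 , j) in the word x ∷ w.
occFirst : ∀ {n} → Fin n → List (Fin n) → ℕ
occFirst x []       = 0
occFirst x (y ∷ rest) with x <? y
... | yes _ = length (filter (λ z → y <? z) rest)
... | no _  = 0

occ12-3 : ∀ {n} → List (Fin n) → ℕ
occ12-3 []       = 0
occ12-3 (x ∷ w)  = occFirst x w +ℕ occ12-3 w

u : ℕ → ℕ → ℕ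
u r n = length (filter (λ v → occ12-3 (toList v) ℕₚ.≟ r) (perms n))

PS : Set
PS = ℕ → ℤ

sumTo : ℕ → (ℕ → ℤ) → ℤ
sumTo zero    f = f 0
sumTo (suc n) f = sumTo n f + f (suc n)

one : PS
one zero    = + 1
one (suc _) = + 0

_⊛_ : PS → PS → PS
(f ⊛ g) n = sumTo n (λ k → f k * g (n ∸ k))

_^ₚ_ : PS → ℕ → PS
g ^ₚ zero  = one
g ^ₚ suc k = g ⊛ (g ^ₚ k)

_⊕_ : PS → PS → PS
(f ⊕ g) n = f n + g n

_⊖_ : PS → PS → PS
(f ⊖ g) n = f n - g n

-- Composition f(g(x)) = Σ_k f_k g(x)^k, for g with zero constant term
-- (then g^k has no terms below x^k, so the coefficient of x^n only
-- involves k ≤ n).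
_∘ₚ_ : PS → PS → PS
(f ∘ₚ g) n = sumTo n (λ k → f k * (g ^ₚ k) n)

-- x/(1-x) = x + x² + x³ + ⋯
x/1-x : PS
x/1-x zero    = + 0
x/1-x (suc _) = + 1

U : ℕ → PS
U r n = + (u r n)

module Submission where

-- Every permutation of [n + 1] is uniquely a value i followed by a permutation
-- π of [n] whose values ≥ i are shifted up.  This keeps the occurrences of 12-3
-- inside π and adds those starting at position 1, whose number depends only on
-- i and the first value y of π: it is n - 1 - y if i ≤ y and 0 otherwise.
-- Counting the permutations with exactly one occurrence by their first value
-- therefore gives a Pascal-type recurrence in the first value, solved by a
-- binomial transform of u₀ + u₁; at the two largest first values it yields
-- u₁(n+1) - u₁(n) = Σₖ C(n-1, k-1) (u₀(k) + u₁(k)) - u₀(n).  The sum is the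
-- coefficient of xⁿ in U₁(x/(1-x)) + U₀(x/(1-x)), and multiplication by x/(1-x)
-- takes partial sums, which is the claimed identity.

open import Defs
open import Level using (Level)
open import Function using (id; _∘_)
open import Data.Bool using (true; false; if_then_else_)
open import Data.Nat using (ℕ; zero; suc; _+_; _*_; _∸_; _≤_; _<_; _≤?_; _≟_; z≤n; s≤s; z<s)
import Data.Nat.Properties as ℕ
open import Algebra.Properties.CommutativeSemigroup ℕ.+-commutativeSemigroup
  using () renaming (interchange to +-interchange; xy∙z≈xz∙y to +-rightComm)
open import Data.Fin as Fin using (Fin; toℕ; punchIn)
import Data.Fin.Properties as Fin
open import Data.Vec as Vec using (Vec; []; _∷_; toList)
open import Data.Vec.Properties using (toList-map)
open import Data.List
  using (List; []; _∷_; _++_; concat; concatMap; map; filter; length; tabulate; allFin)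
open import Data.List.Properties
  using (map-∘; map-tabulate; concat-map; concatMap-cong; length-map; filter-++; filter-≐; filter-none; filter-accept; filter-reject)
open import Data.List.Relation.Unary.All as All using (All; []; _∷_)
import Data.List.Relation.Unary.All.Properties as All
open import Data.List.Relation.Unary.AllPairs using (_∷_)
import Data.List.Relation.Unary.Unique.Propositional.Properties as Unique
open import Data.Integer as ℤ using (ℤ)
import Data.Integer.Properties as ℤ
open import Data.Integer.Tactic.RingSolver using (solve-∀)
open import Data.Product using (_×_; _,_)
open import Data.Sum using (_⊎_; inj₁; inj₂)
open import Data.Empty using (⊥-elim)
open import Relation.Nullary using (Dec; yes; no; ¬_; does)
open import Relation.Nullary.Decidable using (¬?; _×-dec_; dec-true; dec-false)
open import Relation.Unary using (Pred; Decidable)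
open import Relation.Binary.PropositionalEquality
open ≡-Reasoning

private variable
  ℓ p q : Level
  A B C : Set ℓ

module _ {P : Pred B p} (P? : Decidable P) where

  filter-map : (f : A → B) (xs : List A) → filter P? (map f xs) ≡ map f (filter (P? ∘ f) xs)
  filter-map f []       = refl
  filter-map f (x ∷ xs) with does (P? (f x))
  ... | true  = cong (f x ∷_) (filter-map f xs)
  ... | false = filter-map f xs

  filter-concatMap : (G : A → List B) (xs : List A) →
    filter P? (concatMap G xs) ≡ concatMap (filter P? ∘ G) xs
  filter-concatMap G []       = refl
  filter-concatMap G (x ∷ xs) =
    trans (filter-++ P? (G x) (concatMap G xs)) (cong (filter P? (G x) ++_) (filter-concatMap G xs))

filter-filter : {P : Pred A p} {Q : Pred A q} (P? : Decidable P) (Q? : Decidable Q) (xs : List A) →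
  filter P? (filter Q? xs) ≡ filter (λ x → Q? x ×-dec P? x) xs
filter-filter P? Q? []       = refl
filter-filter P? Q? (x ∷ xs) with Q? x
... | no _  = filter-filter P? Q? xs
... | yes _ with P? x
...   | yes _ = cong (x ∷_) (filter-filter P? Q? xs)
...   | no _  = filter-filter P? Q? xs

map-concatMap : (f : B → C) (G : A → List B) (xs : List A) →
  map f (concatMap G xs) ≡ concatMap (map f ∘ G) xs
map-concatMap f G xs = begin
  map f (concat (map G xs))         ≡⟨ concat-map (map G xs) ⟨
  concat (map (map f) (map G xs))   ≡⟨ cong concat (map-∘ xs) ⟨
  concat (map (map f ∘ G) xs)       ∎

concatMap-allFin-punchIn : ∀ {n} (i : Fin (suc n)) (F : Fin (suc n) → List A) → F i ≡ [] →
  concatMap F (allFin (suc n)) ≡ concatMap (F ∘ punchIn i) (allFin n)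
concatMap-allFin-punchIn {n = n} i F Fi≡[] = begin
  concat (map F (tabulate id))               ≡⟨ cong concat (map-tabulate id F) ⟩
  concat (tabulate F)                        ≡⟨ skip i F Fi≡[] ⟩
  concat (tabulate (F ∘ punchIn i))          ≡⟨ cong concat (map-tabulate id (F ∘ punchIn i)) ⟨
  concat (map (F ∘ punchIn i) (tabulate id)) ∎
  where
  skip : ∀ {n} (i : Fin (suc n)) (F : Fin (suc n) → List A) → F i ≡ [] →
         concat (tabulate F) ≡ concat (tabulate (F ∘ punchIn i))
  skip         Fin.zero    F e = cong (_++ concat (tabulate (F ∘ Fin.suc))) e
  skip {n = suc n} (Fin.suc i) F e = cong (F Fin.zero ++_) (skip i (F ∘ Fin.suc) e)

length-filter-map : {P : Pred B p} {Q : Pred A q} (P? : Decidable P) (Q? : Decidable Q) (f : A → B) →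
  (∀ {x} → P (f x) → Q x) → (∀ {x} → Q x → P (f x)) →
  ∀ xs → length (filter P? (map f xs)) ≡ length (filter Q? xs)
length-filter-map P? Q? f P⇒Q Q⇒P xs = begin
  length (filter P? (map f xs))          ≡⟨ cong length (filter-map P? f xs) ⟩
  length (map f (filter (P? ∘ f) xs))    ≡⟨ length-map f (filter (P? ∘ f) xs) ⟩
  length (filter (P? ∘ f) xs)            ≡⟨ cong length (filter-≐ (P? ∘ f) Q? (P⇒Q , Q⇒P) xs) ⟩
  length (filter Q? xs)                  ∎

χ : ∀ {P : Set p} → Dec P → ℕ
χ P? = if does P? then 1 else 0

χ-yes : ∀ {P : Set p} (P? : Dec P) → P → χ P? ≡ 1
χ-yes P? p rewrite dec-true P? p = refl

χ-no : ∀ {P : Set p} (P? : Dec P) → ¬ P → χ P? ≡ 0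
χ-no P? ¬p rewrite dec-false P? ¬p = refl

χ-cong : ∀ {P : Set p} {Q : Set q} → (P → Q) → (Q → P) → (P? : Dec P) (Q? : Dec Q) → χ P? ≡ χ Q?
χ-cong P⇒Q Q⇒P (yes p) (yes q) = refl
χ-cong P⇒Q Q⇒P (yes p) (no ¬q) = ⊥-elim (¬q (P⇒Q p))
χ-cong P⇒Q Q⇒P (no ¬p) (yes q) = ⊥-elim (¬p (Q⇒P q))
χ-cong P⇒Q Q⇒P (no ¬p) (no ¬q) = refl

χ-+≟ : ∀ a {d r} → d ≤ r → χ (a + d ≟ r) ≡ χ (a ≟ r ∸ d)
χ-+≟ a {d} {r} d≤r = χ-cong (λ eq → trans (sym (ℕ.m+n∸n≡m a d)) (cong (_∸ d) eq))
                            (λ eq → trans (cong (_+ d) eq) (ℕ.m∸n+n≡m d≤r))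
                            (a + d ≟ r) (a ≟ r ∸ d)

χ-+≟-> : ∀ a {d r} → ¬ d ≤ r → χ (a + d ≟ r) ≡ 0
χ-+≟-> a {d} {r} d≰r = χ-no (a + d ≟ r) (λ eq → d≰r (subst (d ≤_) eq (ℕ.m≤n+m d a)))

*χ≟-subst : ∀ (Φ : ℕ → ℕ) x y → Φ x * χ (x ≟ y) ≡ Φ y * χ (x ≟ y)
*χ≟-subst Φ x y with x ≟ y
... | yes refl = refl
... | no x≢y  = begin
  Φ x * χ (x ≟ y)   ≡⟨ cong (Φ x *_) (χ-no (x ≟ y) x≢y) ⟩
  Φ x * 0           ≡⟨ ℕ.*-zeroʳ (Φ x) ⟩
  0                 ≡⟨ ℕ.*-zeroʳ (Φ y) ⟨
  Φ y * 0           ≡⟨ cong (Φ y *_) (χ-no (x ≟ y) x≢y) ⟨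
  Φ y * χ (x ≟ y)   ∎

∑ : (A → ℕ) → List A → ℕ
∑ f []       = 0
∑ f (x ∷ xs) = f x + ∑ f xs

infix 5 ∑
syntax ∑ (λ x → e) xs = ∑[ x ∈ xs ] e

∑< : ℕ → (ℕ → ℕ) → ℕ
∑< zero    f = 0
∑< (suc N) f = ∑< N f + f N

infix 5 ∑<
syntax ∑< N (λ i → e) = ∑[ i < N ] e

module _ {f g : A → ℕ} where

  ∑-cong-local : ∀ {xs} → All (λ x → f x ≡ g x) xs → ∑ f xs ≡ ∑ g xs
  ∑-cong-local []         = refl
  ∑-cong-local (eq ∷ eqs) = cong₂ _+_ eq (∑-cong-local eqs)

  ∑-cong : (∀ x → f x ≡ g x) → ∀ xs → ∑ f xs ≡ ∑ g xs
  ∑-cong f≡g xs = ∑-cong-local (All.universal f≡g xs)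

  ∑-+ : ∀ xs → ∑[ x ∈ xs ] (f x + g x) ≡ ∑ f xs + ∑ g xs
  ∑-+ []       = refl
  ∑-+ (x ∷ xs) = trans (cong (f x + g x +_) (∑-+ xs)) (+-interchange (f x) (g x) (∑ f xs) (∑ g xs))

∑-zero : (xs : List A) → ∑[ x ∈ xs ] 0 ≡ 0
∑-zero []       = refl
∑-zero (_ ∷ xs) = ∑-zero xs

∑-*ʳ : (f : A → ℕ) (k : ℕ) (xs : List A) → ∑[ x ∈ xs ] (f x * k) ≡ ∑ f xs * k
∑-*ʳ f k []       = refl
∑-*ʳ f k (x ∷ xs) = trans (cong (f x * k +_) (∑-*ʳ f k xs)) (sym (ℕ.*-distribʳ-+ k (f x) (∑ f xs)))

∑-map : (f : B → ℕ) (h : A → B) (xs : List A) → ∑ f (map h xs) ≡ ∑ (f ∘ h) xs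
∑-map f h []       = refl
∑-map f h (x ∷ xs) = cong (f (h x) +_) (∑-map f h xs)

∑-++ : (f : A → ℕ) (xs ys : List A) → ∑ f (xs ++ ys) ≡ ∑ f xs + ∑ f ys
∑-++ f []       ys = refl
∑-++ f (x ∷ xs) ys = trans (cong (f x +_) (∑-++ f xs ys)) (sym (ℕ.+-assoc (f x) (∑ f xs) (∑ f ys)))

∑-concatMap : (f : B → ℕ) (G : A → List B) (xs : List A) → ∑ f (concatMap G xs) ≡ ∑[ x ∈ xs ] ∑ f (G x)
∑-concatMap f G []       = refl
∑-concatMap f G (x ∷ xs) = trans (∑-++ f (G x) (concatMap G xs)) (cong (∑ f (G x) +_) (∑-concatMap f G xs))

length-filter≡∑χ : {P : Pred A p} (P? : Decidable P) (xs : List A) → length (filter P? xs) ≡ ∑[ x ∈ xs ] χ (P? x)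
length-filter≡∑χ P? []       = refl
length-filter≡∑χ P? (x ∷ xs) with does (P? x)
... | true  = cong suc (length-filter≡∑χ P? xs)
... | false = length-filter≡∑χ P? xs

∑<-cong : ∀ N {f g : ℕ → ℕ} → (∀ i → i < N → f i ≡ g i) → ∑< N f ≡ ∑< N g
∑<-cong zero    eq = refl
∑<-cong (suc N) eq = cong₂ _+_ (∑<-cong N (λ i i<N → eq i (ℕ.m≤n⇒m≤1+n i<N))) (eq N ℕ.≤-refl)

∑<-+ : ∀ N (f g : ℕ → ℕ) → ∑[ i < N ] (f i + g i) ≡ ∑< N f + ∑< N g
∑<-+ zero    f g = refl
∑<-+ (suc N) f g = trans (cong (_+ (f N + g N)) (∑<-+ N f g)) (+-interchange (∑< N f) (∑< N g) (f N) (g N))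

∑<-zero : ∀ N → ∑[ i < N ] 0 ≡ 0
∑<-zero zero    = refl
∑<-zero (suc N) = trans (ℕ.+-identityʳ _) (∑<-zero N)

∑<-suc : ∀ N (f : ℕ → ℕ) → ∑< (suc N) f ≡ f 0 + (∑[ i < N ] f (suc i))
∑<-suc zero    f = ℕ.+-comm 0 (f 0)
∑<-suc (suc N) f = trans (cong (_+ f (suc N)) (∑<-suc N f)) (ℕ.+-assoc (f 0) _ _)

∑-allFin : ∀ m (g : ℕ → ℕ) → ∑[ i ∈ allFin m ] g (toℕ i) ≡ ∑< m g
∑-allFin zero    g = refl
∑-allFin (suc m) g = begin
  g 0 + ∑ (g ∘ toℕ) (tabulate (Fin.suc {m}))    ≡⟨ cong (λ xs → g 0 + ∑ (g ∘ toℕ) xs) (map-tabulate {n = m} id Fin.suc) ⟨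
  g 0 + ∑ (g ∘ toℕ) (map Fin.suc (allFin m))     ≡⟨ cong (g 0 +_) (∑-map (g ∘ toℕ) Fin.suc (allFin m)) ⟩
  g 0 + (∑[ i ∈ allFin m ] g (suc (toℕ i)))      ≡⟨ cong (g 0 +_) (∑-allFin m (g ∘ suc)) ⟩
  g 0 + ∑< m (g ∘ suc)                           ≡⟨ ∑<-suc m g ⟨
  ∑< (suc m) g                                   ∎

∑-∑<-comm : ∀ N (F : A → ℕ → ℕ) (xs : List A) → ∑[ x ∈ xs ] ∑< N (F x) ≡ ∑[ y < N ] ∑[ x ∈ xs ] F x y
∑-∑<-comm N F []       = sym (∑<-zero N)
∑-∑<-comm N F (x ∷ xs) =
  trans (cong (∑< N (F x) +_) (∑-∑<-comm N F xs)) (sym (∑<-+ N (F x) (λ y → ∑[ x ∈ xs ] F x y)))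

module _ {R : ℕ → Set p} (R? : ∀ i → Dec (R i)) {v} (R⇒≡v : ∀ {i} → R i → i ≡ v) (Rv : R v) (g : ℕ → ℕ) where

  ∑<-select-below : ∀ N → N ≤ v → ∑[ i < N ] g i * χ (R? i) ≡ 0
  ∑<-select-below zero    _   = refl
  ∑<-select-below (suc N) N<v = begin
    (∑[ i < N ] g i * χ (R? i)) + g N * χ (R? N)
      ≡⟨ cong₂ _+_ (∑<-select-below N (ℕ.<⇒≤ N<v)) (cong (g N *_) (χ-no (R? N) (ℕ.<⇒≢ N<v ∘ R⇒≡v))) ⟩
    g N * 0                                      ≡⟨ ℕ.*-zeroʳ (g N) ⟩
    0                                            ∎

  ∑<-select : ∀ N → v < N → ∑[ i < N ] g i * χ (R? i) ≡ g v
  ∑<-select (suc N) v<1+N with v ≟ N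
  ... | yes refl = begin
    (∑[ i < v ] g i * χ (R? i)) + g v * χ (R? v)  ≡⟨ cong₂ _+_ (∑<-select-below v ℕ.≤-refl) (cong (g v *_) (χ-yes (R? v) Rv)) ⟩
    g v * 1                                      ≡⟨ ℕ.*-identityʳ (g v) ⟩
    g v                                          ∎
  ... | no v≢N = begin
    (∑[ i < N ] g i * χ (R? i)) + g N * χ (R? N)
      ≡⟨ cong₂ _+_ (∑<-select N (ℕ.≤∧≢⇒< (ℕ.≤-pred v<1+N) v≢N)) (cong (g N *_) (χ-no (R? N) (v≢N ∘ sym ∘ R⇒≡v))) ⟩
    g v + g N * 0                                ≡⟨ cong (g v +_) (ℕ.*-zeroʳ (g N)) ⟩
    g v + 0                                      ≡⟨ ℕ.+-identityʳ (g v) ⟩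
    g v                                          ∎

∑-partition : ∀ N (h f : A → ℕ) {xs} → All (λ x → h x < N) xs →
  ∑ f xs ≡ ∑[ y < N ] ∑[ x ∈ xs ] f x * χ (h x ≟ y)
∑-partition N h f {xs} h<N = begin
  ∑ f xs
    ≡⟨ ∑-cong-local (All.map (λ {x} → sym ∘ ∑<-select (h x ≟_) sym refl (λ _ → f x) N) h<N) ⟩
  ∑[ x ∈ xs ] ∑[ y < N ] f x * χ (h x ≟ y)     ≡⟨ ∑-∑<-comm N (λ x y → f x * χ (h x ≟ y)) xs ⟩
  ∑[ y < N ] ∑[ x ∈ xs ] f x * χ (h x ≟ y)     ∎

∑<-differ-at : ∀ N v (f g : ℕ → ℕ) → v < N → (∀ y → y < N → y ≢ v → f y ≡ g y) →
  ∑< N f + g v ≡ ∑< N g + f v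
∑<-differ-at (suc N) v f g v<1+N f≡g with v ≟ N
... | yes refl = begin
  ∑< v f + f v + g v  ≡⟨ cong (λ s → s + f v + g v) (∑<-cong v (λ y y<v → f≡g y (ℕ.m≤n⇒m≤1+n y<v) (ℕ.<⇒≢ y<v))) ⟩
  ∑< v g + f v + g v  ≡⟨ +-rightComm (∑< v g) (f v) (g v) ⟩
  ∑< v g + g v + f v  ∎
... | no v≢N = begin
  ∑< N f + f N + g v  ≡⟨ +-rightComm (∑< N f) (f N) (g v) ⟩
  ∑< N f + g v + f N  ≡⟨ cong₂ _+_ (∑<-differ-at N v f g v<N (λ y y<N → f≡g y (ℕ.m≤n⇒m≤1+n y<N)))
                                   (f≡g N ℕ.≤-refl (v≢N ∘ sym)) ⟩
  ∑< N g + f v + g N  ≡⟨ +-rightComm (∑< N g) (f v) (g N) ⟩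
  ∑< N g + g N + f v  ∎
  where v<N = ℕ.≤∧≢⇒< (ℕ.≤-pred v<1+N) v≢N

-- Composition with x/(1-x)

powCoeff : ℕ → ℕ → ℕ
powCoeff zero    zero    = 1
powCoeff zero    (suc _) = 0
powCoeff (suc k) n       = ∑< n (powCoeff k)

powCoeff-< : ∀ k n → n < k → powCoeff k n ≡ 0
powCoeff-< (suc k) n n<1+k = trans (∑<-cong n (λ j j<n → powCoeff-< k j (ℕ.<-≤-trans j<n (ℕ.≤-pred n<1+k)))) (∑<-zero n)

composed : (ℕ → ℕ) → ℕ → ℕ
composed f n = ∑[ k < suc n ] powCoeff k n * f k

composed-cong : ∀ {f g : ℕ → ℕ} → (∀ k → f k ≡ g k) → ∀ n → composed f n ≡ composed g n
composed-cong f≡g n = ∑<-cong (suc n) (λ k _ → cong (powCoeff k n *_) (f≡g k))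

composed-+ : ∀ (f g : ℕ → ℕ) n → composed (λ k → f k + g k) n ≡ composed f n + composed g n
composed-+ f g n = trans (∑<-cong (suc n) (λ k _ → ℕ.*-distribˡ-+ (powCoeff k n) (f k) (g k)))
                         (∑<-+ (suc n) (λ k → powCoeff k n * f k) (λ k → powCoeff k n * g k))

-- Pascal's rule powCoeff (suc k) (suc n) ≡ powCoeff (suc k) n + powCoeff k n holds by definition.
composed-suc : ∀ f n → composed f (suc (suc n)) ≡ composed (f ∘ suc) (suc n) + composed f (suc n)
composed-suc f n = begin
  composed f (suc (suc n))
    ≡⟨ ∑<-suc (suc (suc n)) (λ k → powCoeff k (suc (suc n)) * f k) ⟩
  ∑[ k < suc (suc n) ] (powCoeff (suc k) (suc n) + powCoeff k (suc n)) * f (suc k)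
    ≡⟨ ∑<-cong (suc (suc n)) (λ k _ → ℕ.*-distribʳ-+ (f (suc k)) (powCoeff (suc k) (suc n)) (powCoeff k (suc n))) ⟩
  ∑[ k < suc (suc n) ] (powCoeff (suc k) (suc n) * f (suc k) + powCoeff k (suc n) * f (suc k))
    ≡⟨ ∑<-+ (suc (suc n)) _ _ ⟩
  (∑[ k < suc (suc n) ] powCoeff (suc k) (suc n) * f (suc k)) + composed (f ∘ suc) (suc n)
    ≡⟨ cong (_+ composed (f ∘ suc) (suc n)) drop-top ⟩
  composed f (suc n) + composed (f ∘ suc) (suc n)
    ≡⟨ ℕ.+-comm (composed f (suc n)) _ ⟩
  composed (f ∘ suc) (suc n) + composed f (suc n) ∎
  where
  drop-top : ∑[ k < suc (suc n) ] powCoeff (suc k) (suc n) * f (suc k) ≡ composed f (suc n)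
  drop-top = begin
    (∑[ k < suc n ] powCoeff (suc k) (suc n) * f (suc k)) + powCoeff (suc (suc n)) (suc n) * f (suc (suc n))
      ≡⟨ cong (λ c → (∑[ k < suc n ] powCoeff (suc k) (suc n) * f (suc k)) + c * f (suc (suc n)))
              (powCoeff-< (suc (suc n)) (suc n) ℕ.≤-refl) ⟩
    (∑[ k < suc n ] powCoeff (suc k) (suc n) * f (suc k)) + 0
      ≡⟨ ℕ.+-identityʳ _ ⟩
    ∑[ k < suc n ] powCoeff (suc k) (suc n) * f (suc k)
      ≡⟨ ∑<-suc (suc n) (λ k → powCoeff k (suc n) * f k) ⟨
    composed f (suc n) ∎

sumTo-suc : ∀ n (f : ℕ → ℤ) → sumTo (suc n) f ≡ f 0 ℤ.+ sumTo n (f ∘ suc)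
sumTo-suc zero    f = refl
sumTo-suc (suc n) f = trans (cong (ℤ._+ f (suc (suc n))) (sumTo-suc n f)) (ℤ.+-assoc (f 0) _ _)

sumTo-cong : ∀ n {f g : ℕ → ℤ} → (∀ k → f k ≡ g k) → sumTo n f ≡ sumTo n g
sumTo-cong zero    f≡g = f≡g 0
sumTo-cong (suc n) f≡g = cong₂ ℤ._+_ (sumTo-cong n f≡g) (f≡g (suc n))

sumTo-+ : ∀ n (f : ℕ → ℕ) → sumTo n (λ k → ℤ.+ f k) ≡ ℤ.+ ∑< (suc n) f
sumTo-+ zero    f = refl
sumTo-+ (suc n) f = trans (cong (ℤ._+ ℤ.+ f (suc n)) (sumTo-+ n f)) (sym (ℤ.pos-+ (∑< (suc n) f) (f (suc n))))

x/1-x-⊛ : ∀ h n → (x/1-x ⊛ h) (suc n) ≡ sumTo n (λ k → h (n ∸ k))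
x/1-x-⊛ h n = begin
  (x/1-x ⊛ h) (suc n)                               ≡⟨ sumTo-suc n (λ k → x/1-x k ℤ.* h (suc n ∸ k)) ⟩
  ℤ.0ℤ ℤ.+ sumTo n (λ k → ℤ.1ℤ ℤ.* h (n ∸ k))       ≡⟨ ℤ.+-identityˡ _ ⟩
  sumTo n (λ k → ℤ.1ℤ ℤ.* h (n ∸ k))                ≡⟨ sumTo-cong n (λ k → ℤ.*-identityˡ (h (n ∸ k))) ⟩
  sumTo n (λ k → h (n ∸ k))                         ∎

x/1-x-⊛-suc : ∀ h n → (x/1-x ⊛ h) (suc n) ≡ (x/1-x ⊛ h) n ℤ.+ h n
x/1-x-⊛-suc h zero    = trans (x/1-x-⊛ h 0) (sym (ℤ.+-identityˡ (h 0)))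
x/1-x-⊛-suc h (suc n) = begin
  (x/1-x ⊛ h) (suc (suc n))               ≡⟨ x/1-x-⊛ h (suc n) ⟩
  sumTo (suc n) (λ k → h (suc n ∸ k))     ≡⟨ sumTo-suc n (λ k → h (suc n ∸ k)) ⟩
  h (suc n) ℤ.+ sumTo n (λ k → h (n ∸ k)) ≡⟨ cong (ℤ._+_ (h (suc n))) (x/1-x-⊛ h n) ⟨
  h (suc n) ℤ.+ (x/1-x ⊛ h) (suc n)       ≡⟨ ℤ.+-comm (h (suc n)) _ ⟩
  (x/1-x ⊛ h) (suc n) ℤ.+ h (suc n)       ∎

x/1-x-^ₚ : ∀ k n → (x/1-x ^ₚ k) n ≡ ℤ.+ powCoeff k n
x/1-x-^ₚ zero    zero    = refl
x/1-x-^ₚ zero    (suc n) = refl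
x/1-x-^ₚ (suc k) zero    = refl
x/1-x-^ₚ (suc k) (suc n) = begin
  (x/1-x ⊛ (x/1-x ^ₚ k)) (suc n)                      ≡⟨ x/1-x-⊛-suc (x/1-x ^ₚ k) n ⟩
  (x/1-x ^ₚ suc k) n ℤ.+ (x/1-x ^ₚ k) n               ≡⟨ cong₂ ℤ._+_ (x/1-x-^ₚ (suc k) n) (x/1-x-^ₚ k n) ⟩
  ℤ.+ powCoeff (suc k) n ℤ.+ ℤ.+ powCoeff k n          ≡⟨ ℤ.pos-+ (powCoeff (suc k) n) (powCoeff k n) ⟨
  ℤ.+ powCoeff (suc k) (suc n)                         ∎

∘ₚ-x/1-x : ∀ (f : ℕ → ℕ) n → ((λ k → ℤ.+ f k) ∘ₚ x/1-x) n ≡ ℤ.+ composed f n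
∘ₚ-x/1-x f n = trans (sumTo-cong n term) (sumTo-+ n (λ k → powCoeff k n * f k))
  where
  term : ∀ k → ℤ.+ f k ℤ.* (x/1-x ^ₚ k) n ≡ ℤ.+ (powCoeff k n * f k)
  term k = begin
    ℤ.+ f k ℤ.* (x/1-x ^ₚ k) n         ≡⟨ cong (ℤ._*_ (ℤ.+ f k)) (x/1-x-^ₚ k n) ⟩
    ℤ.+ f k ℤ.* ℤ.+ powCoeff k n        ≡⟨ ℤ.pos-* (f k) (powCoeff k n) ⟨
    ℤ.+ (f k * powCoeff k n)            ≡⟨ cong ℤ.+_ (ℕ.*-comm (f k) (powCoeff k n)) ⟩
    ℤ.+ (powCoeff k n * f k)            ∎

-- Permutations of [n + 1] from permutations of [n]

prepend : ∀ {n} → Fin (suc n) → Vec (Fin n) n → Vec (Fin (suc n)) (suc n)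
prepend i π = i ∷ Vec.map (punchIn i) π

module _ {k m : ℕ} where

  Avoids : Fin k → Vec (Fin k) m → Set
  Avoids i w = All (i ≢_) (toList w)

  avoids? : (i : Fin k) → Decidable (Avoids i)
  avoids? i w = All.all? (λ z → ¬? (i Fin.≟ z)) (toList w)

  unique? : Decidable (λ (w : Vec (Fin k) m) → UniqueFin.Unique k (toList w))
  unique? w = UniqueFin.unique? k (toList w)

allWords-avoiding : ∀ {k} m (i : Fin (suc k)) →
  filter (avoids? i) (allWords m) ≡ map (Vec.map (punchIn i)) (allWords {k} m)
allWords-avoiding         zero    i = refl
allWords-avoiding {k = k} (suc m) i = begin
  filter (avoids? i) (concatMap G (allFin (suc k)))
    ≡⟨ filter-concatMap (avoids? i) G (allFin (suc k)) ⟩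
  concatMap (filter (avoids? i) ∘ G) (allFin (suc k))
    ≡⟨ concatMap-allFin-punchIn i (filter (avoids? i) ∘ G) G-i-rejected ⟩
  concatMap (filter (avoids? i) ∘ G ∘ punchIn i) (allFin k)
    ≡⟨ concatMap-cong G-punchIn (allFin k) ⟩
  concatMap (map punched ∘ G′) (allFin k)
    ≡⟨ map-concatMap punched G′ (allFin k) ⟨
  map punched (concatMap G′ (allFin k)) ∎
  where
  G  = λ (j : Fin (suc k)) → map (j ∷_) (allWords {suc k} m)
  G′ = λ (j : Fin k) → map (j ∷_) (allWords {k} m)
  punched : ∀ {l} → Vec (Fin k) l → Vec (Fin (suc k)) l
  punched = Vec.map (punchIn i)

  G-i-rejected : filter (avoids? i) (G i) ≡ []
  G-i-rejected = filter-none (avoids? i) (All.map⁺ (All.universal (λ { _ (i≢i ∷ _) → i≢i refl }) (allWords m)))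

  G-punchIn : ∀ j → filter (avoids? i) (G (punchIn i j)) ≡ map punched (G′ j)
  G-punchIn j = begin
    filter (avoids? i) (map (punchIn i j ∷_) (allWords m))
      ≡⟨ filter-map (avoids? i) (punchIn i j ∷_) (allWords m) ⟩
    map (punchIn i j ∷_) (filter (avoids? i ∘ (punchIn i j ∷_)) (allWords m))
      ≡⟨ cong (map (punchIn i j ∷_)) (filter-≐ _ (avoids? i) ((λ { (_ ∷ a) → a }) , (i≢ ∷_)) (allWords m)) ⟩
    map (punchIn i j ∷_) (filter (avoids? i) (allWords m))
      ≡⟨ cong (map (punchIn i j ∷_)) (allWords-avoiding m i) ⟩
    map (punchIn i j ∷_) (map punched (allWords m))
      ≡⟨ map-∘ (allWords m) ⟨
    map (λ w → punchIn i j ∷ punched w) (allWords m)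
      ≡⟨ map-∘ (allWords m) ⟩
    map punched (G′ j) ∎
    where
    i≢ : i ≢ punchIn i j
    i≢ = Fin.punchInᵢ≢i i j ∘ sym

perms-suc : ∀ n → perms (suc n) ≡ concatMap (λ i → map (prepend i) (perms n)) (allFin (suc n))
perms-suc n = begin
  filter unique? (concatMap G (allFin (suc n)))      ≡⟨ filter-concatMap unique? G (allFin (suc n)) ⟩
  concatMap (filter unique? ∘ G) (allFin (suc n))    ≡⟨ concatMap-cong G-unique (allFin (suc n)) ⟩
  concatMap (λ i → map (prepend i) (perms n)) (allFin (suc n)) ∎
  where
  G = λ (i : Fin (suc n)) → map (i ∷_) (allWords {suc n} n)

  G-unique : ∀ i → filter unique? (G i) ≡ map (prepend i) (perms n)
  G-unique i = begin
    filter unique? (map (i ∷_) (allWords n))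
      ≡⟨ filter-map unique? (i ∷_) (allWords n) ⟩
    map (i ∷_) (filter (unique? ∘ (i ∷_)) (allWords n))
      ≡⟨ cong (map (i ∷_)) (filter-≐ _ _ ((λ { (a ∷ u) → a , u }) , λ { (a , u) → a ∷ u }) (allWords n)) ⟩
    map (i ∷_) (filter (λ w → avoids? i w ×-dec unique? w) (allWords n))
      ≡⟨ cong (map (i ∷_)) (filter-filter unique? (avoids? i) (allWords n)) ⟨
    map (i ∷_) (filter unique? (filter (avoids? i) (allWords n)))
      ≡⟨ cong (map (i ∷_) ∘ filter unique?) (allWords-avoiding n i) ⟩
    map (i ∷_) (filter unique? (map punched (allWords n)))
      ≡⟨ cong (map (i ∷_)) (filter-map unique? punched (allWords n)) ⟩
    map (i ∷_) (map punched (filter (unique? ∘ punched) (allWords n)))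
      ≡⟨ cong (map (i ∷_) ∘ map punched) (filter-≐ _ unique? (unpunch , punch) (allWords n)) ⟩
    map (i ∷_) (map punched (perms n))
      ≡⟨ map-∘ (perms n) ⟨
    map (prepend i) (perms n) ∎
    where
    punched : ∀ {l} → Vec (Fin n) l → Vec (Fin (suc n)) l
    punched = Vec.map (punchIn i)
    unpunch : ∀ {w} → UniqueFin.Unique (suc n) (toList (punched w)) → UniqueFin.Unique n (toList w)
    unpunch {w} u = Unique.map⁻ (subst (UniqueFin.Unique (suc n)) (toList-map (punchIn i) w) u)
    punch : ∀ {w} → UniqueFin.Unique n (toList w) → UniqueFin.Unique (suc n) (toList (punched w))
    punch {w} u = subst (UniqueFin.Unique (suc n)) (sym (toList-map (punchIn i) w))
                        (Unique.map⁺ (Fin.punchIn-injective i _ _) u)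

All-perms-suc : ∀ {n} {Q : Pred (Vec (Fin (suc n)) (suc n)) p} →
  (∀ i → All (Q ∘ prepend i) (perms n)) → All Q (perms (suc n))
All-perms-suc {n = n} {Q = Q} Q-prepend =
  subst (All Q) (sym (perms-suc n)) (All.concat⁺ (All.map⁺ (All.universal (λ i → All.map⁺ (Q-prepend i)) (allFin (suc n)))))

-- Occurrences gained by prepending a value

module _ {m k} (f : Fin m → Fin k)
  (f-mono : ∀ {x y} → x Fin.< y → f x Fin.< f y) (f-cancel : ∀ {x y} → f x Fin.< f y → x Fin.< y) where

  occFirst-map : ∀ x (ys : List (Fin m)) → occFirst (f x) (map f ys) ≡ occFirst x ys
  occFirst-map x []         = refl
  occFirst-map x (y ∷ rest) with f x Fin.<? f y | x Fin.<? y
  ... | yes _   | yes _   = length-filter-map (f y Fin.<?_) (y Fin.<?_) f f-cancel f-mono rest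
  ... | yes fx<fy | no x≮y  = ⊥-elim (x≮y (f-cancel fx<fy))
  ... | no fx≮fy  | yes x<y = ⊥-elim (fx≮fy (f-mono x<y))
  ... | no _    | no _    = refl

  occ12-3-map : (xs : List (Fin m)) → occ12-3 (map f xs) ≡ occ12-3 xs
  occ12-3-map []       = refl
  occ12-3-map (x ∷ xs) = cong₂ _+_ (occFirst-map x xs) (occ12-3-map xs)

punchIn-mono-< : ∀ {n} (i : Fin (suc n)) {x y : Fin n} → x Fin.< y → punchIn i x Fin.< punchIn i y
punchIn-mono-< i {x} {y} x<y =
  Fin.≤∧≢⇒< (Fin.punchIn-mono-≤ i x y (ℕ.<⇒≤ x<y)) (Fin.<⇒≢ x<y ∘ Fin.punchIn-injective i x y)

punchIn-cancel-< : ∀ {n} (i : Fin (suc n)) {x y : Fin n} → punchIn i x Fin.< punchIn i y → x Fin.< y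
punchIn-cancel-< i {x} {y} ix<iy =
  Fin.≤∧≢⇒< (Fin.punchIn-cancel-≤ i x y (ℕ.<⇒≤ ix<iy)) (Fin.<⇒≢ ix<iy ∘ cong (punchIn i))

toℕ-punchIn : ∀ {n} (i : Fin (suc n)) (j : Fin n) →
  (toℕ j < toℕ i × toℕ (punchIn i j) ≡ toℕ j) ⊎ (toℕ i ≤ toℕ j × toℕ (punchIn i j) ≡ suc (toℕ j))
toℕ-punchIn Fin.zero    j           = inj₂ (z≤n , refl)
toℕ-punchIn (Fin.suc i) Fin.zero    = inj₁ (s≤s z≤n , refl)
toℕ-punchIn (Fin.suc i) (Fin.suc j) with toℕ-punchIn i j
... | inj₁ (j<i , eq) = inj₁ (s≤s j<i , cong suc eq)
... | inj₂ (i≤j , eq) = inj₂ (s≤s i≤j , cong suc eq)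

atLeast : ∀ {k} → ℕ → List (Fin k) → ℕ
atLeast t = length ∘ filter (λ z → t ≤? toℕ z)

atLeast-accept : ∀ {k t} {x : Fin k} {xs} → t ≤ toℕ x → atLeast t (x ∷ xs) ≡ suc (atLeast t xs)
atLeast-accept t≤x = cong length (filter-accept (λ z → _ ≤? toℕ z) t≤x)

atLeast-reject : ∀ {k t} {x : Fin k} {xs} → ¬ t ≤ toℕ x → atLeast t (x ∷ xs) ≡ atLeast t xs
atLeast-reject t≰x = cong length (filter-reject (λ z → _ ≤? toℕ z) t≰x)

module _ {n} (i : Fin (suc n)) where

  atLeast-punchIn-≤ : ∀ {t} → t ≤ toℕ i → (xs : List (Fin n)) → atLeast t (map (punchIn i) xs) ≡ atLeast t xs
  atLeast-punchIn-≤ {t} t≤i = length-filter-map _ _ (punchIn i) to from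
    where
    to : ∀ {z} → t ≤ toℕ (punchIn i z) → t ≤ toℕ z
    to {z} t≤iz with toℕ-punchIn i z
    ... | inj₁ (_ , eq)   = subst (t ≤_) eq t≤iz
    ... | inj₂ (i≤z , _)  = ℕ.≤-trans t≤i i≤z
    from : ∀ {z} → t ≤ toℕ z → t ≤ toℕ (punchIn i z)
    from {z} t≤z with toℕ-punchIn i z
    ... | inj₁ (_ , eq) = subst (t ≤_) (sym eq) t≤z
    ... | inj₂ (_ , eq) = subst (t ≤_) (sym eq) (ℕ.m≤n⇒m≤1+n t≤z)

  atLeast-punchIn-≥ : ∀ {t} → toℕ i ≤ t → (xs : List (Fin n)) → atLeast (suc t) (map (punchIn i) xs) ≡ atLeast t xs
  atLeast-punchIn-≥ {t} i≤t = length-filter-map _ _ (punchIn i) to from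
    where
    to : ∀ {z} → suc t ≤ toℕ (punchIn i z) → t ≤ toℕ z
    to {z} t<iz with toℕ-punchIn i z
    ... | inj₁ (z<i , eq) = ⊥-elim (ℕ.<⇒≱ (subst (t <_) eq t<iz) (ℕ.≤-trans (ℕ.<⇒≤ z<i) i≤t))
    ... | inj₂ (_ , eq)   = ℕ.≤-pred (subst (suc t ≤_) eq t<iz)
    from : ∀ {z} → t ≤ toℕ z → suc t ≤ toℕ (punchIn i z)
    from {z} t≤z with toℕ-punchIn i z
    ... | inj₁ (z<i , _) = ⊥-elim (ℕ.<⇒≱ z<i (ℕ.≤-trans i≤t t≤z))
    ... | inj₂ (_ , eq)  = subst (suc t ≤_) (sym eq) (s≤s t≤z)

HasRanks : ∀ n → Vec (Fin n) n → Set
HasRanks n π = ∀ t → atLeast t (toList π) ≡ n ∸ t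

hasRanks-prepend : ∀ {n} (i : Fin (suc n)) {π} → HasRanks n π → HasRanks (suc n) (prepend i π)
hasRanks-prepend {n} i {π} ranks t rewrite toList-map (punchIn i) π with t ≤? toℕ i
... | yes t≤i = begin
  atLeast t (i ∷ map (punchIn i) (toList π))      ≡⟨ atLeast-accept t≤i ⟩
  suc (atLeast t (map (punchIn i) (toList π)))   ≡⟨ cong suc (atLeast-punchIn-≤ i t≤i (toList π)) ⟩
  suc (atLeast t (toList π))                      ≡⟨ cong suc (ranks t) ⟩
  suc (n ∸ t)                                     ≡⟨ ℕ.+-∸-assoc 1 (ℕ.≤-trans t≤i (ℕ.≤-pred (Fin.toℕ<n i))) ⟨
  suc n ∸ t                                       ∎
... | no t≰i with t
...   | zero   = ⊥-elim (t≰i z≤n)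
...   | suc t′ = begin
  atLeast (suc t′) (i ∷ map (punchIn i) (toList π))   ≡⟨ atLeast-reject t≰i ⟩
  atLeast (suc t′) (map (punchIn i) (toList π))       ≡⟨ atLeast-punchIn-≥ i (ℕ.≤-pred (ℕ.≰⇒> t≰i)) (toList π) ⟩
  atLeast t′ (toList π)                               ≡⟨ ranks t′ ⟩
  n ∸ t′                                              ∎

perms-haveRanks : ∀ n → All (HasRanks n) (perms n)
perms-haveRanks zero    = (λ t → sym (ℕ.0∸n≡0 t)) ∷ []
perms-haveRanks (suc n) = All-perms-suc (λ i → All.map (hasRanks-prepend i) (perms-haveRanks n))

-- A junk 0 for the empty permutation.
head : ∀ {n} → Vec (Fin n) n → ℕ
head []      = 0
head (x ∷ _) = toℕ x

occ : ∀ {n} → Vec (Fin n) n → ℕ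
occ π = occ12-3 (toList π)

-- Occurrences (1 , j) gained when v is put in front of a permutation of [n]
-- starting with y: they exist iff v ≤ y, and then j ranges over the n ∸ suc y
-- later entries above y.
prependOcc : ℕ → ℕ → ℕ → ℕ
prependOcc n v y = χ (v ≤? y) * (n ∸ suc y)

prependOcc-≤ : ∀ n v y → v ≤ y → prependOcc n v y ≡ n ∸ suc y
prependOcc-≤ n v y v≤y = trans (cong (_* (n ∸ suc y)) (χ-yes (v ≤? y) v≤y)) (ℕ.*-identityˡ (n ∸ suc y))

prependOcc-> : ∀ n {v y} → ¬ v ≤ y → prependOcc n v y ≡ 0
prependOcc-> n {v} {y} v≰y = cong (_* (n ∸ suc y)) (χ-no (v ≤? y) v≰y)

prependOcc-lastValue : ∀ n v {y} → n ≤ suc y → prependOcc n v y ≡ 0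
prependOcc-lastValue n v {y} n≤1+y = trans (cong (χ (v ≤? y) *_) (ℕ.m≤n⇒m∸n≡0 n≤1+y)) (ℕ.*-zeroʳ (χ (v ≤? y)))

prependOcc-large : ∀ n {v} y → n ≤ suc v → prependOcc n v y ≡ 0
prependOcc-large n {v} y n≤1+v with v ≤? y
... | yes v≤y = prependOcc-lastValue n v (ℕ.≤-trans n≤1+v (s≤s v≤y))
... | no v≰y  = prependOcc-> n v≰y

prependOcc-suc : ∀ n {v y} → y ≢ v → prependOcc n (suc v) y ≡ prependOcc n v y
prependOcc-suc n {v} {y} y≢v =
  cong (_* (n ∸ suc y)) (χ-cong ℕ.<⇒≤ (λ v≤y → ℕ.≤∧≢⇒< v≤y (y≢v ∘ sym)) (suc v ≤? y) (v ≤? y))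

occFirst-accept : ∀ {k} {x y : Fin k} {zs} → x Fin.< y → occFirst x (y ∷ zs) ≡ atLeast (suc (toℕ y)) zs
occFirst-accept {x = x} {y} x<y with x Fin.<? y
... | yes _   = refl
... | no x≮y  = ⊥-elim (x≮y x<y)

occFirst-reject : ∀ {k} {x y : Fin k} {zs} → ¬ x Fin.< y → occFirst x (y ∷ zs) ≡ 0
occFirst-reject {x = x} {y} x≮y with x Fin.<? y
... | yes x<y = ⊥-elim (x≮y x<y)
... | no _    = refl

occFirst-prepend : ∀ {n} (i : Fin (suc n)) (π : Vec (Fin n) n) → HasRanks n π →
  occFirst i (map (punchIn i) (toList π)) ≡ prependOcc n (toℕ i) (head π)
occFirst-prepend i [] _ = sym (prependOcc-lastValue 0 (toℕ i) z≤n)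
occFirst-prepend {suc n} i (y ∷ π) ranks with toℕ-punchIn i y
... | inj₁ (y<i , eq) = begin
  occFirst i (punchIn i y ∷ map (punchIn i) (toList π))
    ≡⟨ occFirst-reject {zs = map (punchIn i) (toList π)} (ℕ.<-asym y<i ∘ subst (toℕ i <_) eq) ⟩
  0                                                       ≡⟨ prependOcc-> (suc n) (ℕ.<⇒≱ y<i) ⟨
  prependOcc (suc n) (toℕ i) (toℕ y)                      ∎
... | inj₂ (i≤y , eq) = begin
  occFirst i (punchIn i y ∷ map (punchIn i) (toList π))
    ≡⟨ occFirst-accept {zs = map (punchIn i) (toList π)} (subst (toℕ i <_) (sym eq) (s≤s i≤y)) ⟩
  atLeast (suc (toℕ (punchIn i y))) (map (punchIn i) (toList π))
    ≡⟨ length-filter-map _ _ (punchIn i) (punchIn-cancel-< i) (punchIn-mono-< i) (toList π) ⟩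
  atLeast (suc (toℕ y)) (toList π)                        ≡⟨ atLeast-reject {x = y} {xs = toList π} (ℕ.<-irrefl refl) ⟨
  atLeast (suc (toℕ y)) (y ∷ toList π)                    ≡⟨ ranks (suc (toℕ y)) ⟩
  suc n ∸ suc (toℕ y)                                     ≡⟨ prependOcc-≤ (suc n) (toℕ i) (toℕ y) i≤y ⟨
  prependOcc (suc n) (toℕ i) (toℕ y)                      ∎

occ-prepend : ∀ {n} (i : Fin (suc n)) {π : Vec (Fin n) n} → HasRanks n π →
  occ (prepend i π) ≡ occ π + prependOcc n (toℕ i) (head π)
occ-prepend {n} i {π} ranks rewrite toList-map (punchIn i) π = begin
  occFirst i (map (punchIn i) (toList π)) + occ12-3 (map (punchIn i) (toList π))
    ≡⟨ cong₂ _+_ (occFirst-prepend i π ranks) (occ12-3-map (punchIn i) (punchIn-mono-< i) (punchIn-cancel-< i) (toList π)) ⟩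
  prependOcc n (toℕ i) (head π) + occ π
    ≡⟨ ℕ.+-comm _ (occ π) ⟩
  occ π + prependOcc n (toℕ i) (head π) ∎

-- Counting permutations by their first value

uHead : ℕ → ℕ → ℕ → ℕ
uHead r n y = ∑[ π ∈ perms n ] χ (occ π ≟ r) * χ (head π ≟ y)

u≡∑χ : ∀ r n → u r n ≡ ∑[ π ∈ perms n ] χ (occ π ≟ r)
u≡∑χ r n = length-filter≡∑χ (λ π → occ π ≟ r) (perms n)

head-perms : ∀ n → All (λ π → head π < suc n) (perms (suc n))
head-perms n = All-perms-suc (λ i → All.universal (λ _ → Fin.toℕ<n i) (perms n))

u≡∑uHead : ∀ r n → u r (suc n) ≡ ∑[ y < suc n ] uHead r (suc n) y
u≡∑uHead r n = trans (u≡∑χ r (suc n)) (∑-partition (suc n) head (λ π → χ (occ π ≟ r)) (head-perms n))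

uHead-prepend : ∀ r n v → v < suc n →
  uHead r (suc n) v ≡ ∑[ π ∈ perms n ] χ (occ π + prependOcc n v (head π) ≟ r)
uHead-prepend r n v v<1+n = begin
  ∑ F (perms (suc n))
    ≡⟨ cong (∑ F) (perms-suc n) ⟩
  ∑ F (concatMap (λ i → map (prepend i) (perms n)) (allFin (suc n)))
    ≡⟨ ∑-concatMap F (λ i → map (prepend i) (perms n)) (allFin (suc n)) ⟩
  ∑[ i ∈ allFin (suc n) ] ∑ F (map (prepend i) (perms n))
    ≡⟨ ∑-cong F-prepend (allFin (suc n)) ⟩
  ∑[ i ∈ allFin (suc n) ] ∑ (G (toℕ i)) (perms n) * χ (toℕ i ≟ v)
    ≡⟨ ∑-allFin (suc n) (λ k → ∑ (G k) (perms n) * χ (k ≟ v)) ⟩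
  ∑[ k < suc n ] ∑ (G k) (perms n) * χ (k ≟ v)
    ≡⟨ ∑<-select (_≟ v) id refl (λ k → ∑ (G k) (perms n)) (suc n) v<1+n ⟩
  ∑ (G v) (perms n) ∎
  where
  F = λ (π : Vec (Fin (suc n)) (suc n)) → χ (occ π ≟ r) * χ (head π ≟ v)
  G = λ (w : ℕ) (π : Vec (Fin n) n) → χ (occ π + prependOcc n w (head π) ≟ r)

  F-prepend : ∀ i → ∑ F (map (prepend i) (perms n)) ≡ ∑ (G (toℕ i)) (perms n) * χ (toℕ i ≟ v)
  F-prepend i = begin
    ∑ F (map (prepend i) (perms n))
      ≡⟨ ∑-map F (prepend i) (perms n) ⟩
    ∑ (F ∘ prepend i) (perms n)
      ≡⟨ ∑-cong-local (All.map (λ {π} ranks → cong (λ o → χ (o ≟ r) * χ (toℕ i ≟ v)) (occ-prepend i {π} ranks))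
                               (perms-haveRanks n)) ⟩
    ∑[ π ∈ perms n ] G (toℕ i) π * χ (toℕ i ≟ v)
      ≡⟨ ∑-*ʳ (G (toℕ i)) (χ (toℕ i ≟ v)) (perms n) ⟩
    ∑ (G (toℕ i)) (perms n) * χ (toℕ i ≟ v) ∎

-- Permutations of [n] starting with y that have exactly r occurrences once v is
-- put in front of them.
uPrepend : ℕ → ℕ → ℕ → ℕ → ℕ
uPrepend r n v y = if does (prependOcc n v y ≤? r) then uHead (r ∸ prependOcc n v y) n y else 0

uPrepend-≡ : ∀ r n v y {d} → prependOcc n v y ≡ d → d ≤ r → uPrepend r n v y ≡ uHead (r ∸ d) n y
uPrepend-≡ r n v y refl d≤r rewrite dec-true (prependOcc n v y ≤? r) d≤r = refl

uPrepend-> : ∀ r n v y → ¬ prependOcc n v y ≤ r → uPrepend r n v y ≡ 0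
uPrepend-> r n v y d≰r rewrite dec-false (prependOcc n v y ≤? r) d≰r = refl

uPrepend-suc : ∀ r n {v y} → y ≢ v → uPrepend r n (suc v) y ≡ uPrepend r n v y
uPrepend-suc r n y≢v rewrite prependOcc-suc n y≢v = refl

uHead-suc : ∀ r n v → v < suc (suc n) → uHead r (suc (suc n)) v ≡ ∑[ y < suc n ] uPrepend r (suc n) v y
uHead-suc r n v v<2+n = begin
  uHead r (suc (suc n)) v
    ≡⟨ uHead-prepend r (suc n) v v<2+n ⟩
  ∑[ π ∈ perms (suc n) ] χ (occ π + D (head π) ≟ r)
    ≡⟨ ∑-partition (suc n) head (λ π → χ (occ π + D (head π) ≟ r)) (head-perms n) ⟩
  ∑[ y < suc n ] ∑[ π ∈ perms (suc n) ] χ (occ π + D (head π) ≟ r) * χ (head π ≟ y)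
    ≡⟨ ∑<-cong (suc n) (λ y _ → ∑-cong (λ π → *χ≟-subst (λ h → χ (occ π + D h ≟ r)) (head π) y) (perms (suc n))) ⟩
  ∑[ y < suc n ] ∑[ π ∈ perms (suc n) ] χ (occ π + D y ≟ r) * χ (head π ≟ y)
    ≡⟨ ∑<-cong (suc n) (λ y _ → headFixed y) ⟩
  ∑[ y < suc n ] uPrepend r (suc n) v y ∎
  where
  D = prependOcc (suc n) v

  headFixed : ∀ y → ∑[ π ∈ perms (suc n) ] χ (occ π + D y ≟ r) * χ (head π ≟ y) ≡ uPrepend r (suc n) v y
  headFixed y with D y ≤? r
  ... | yes d≤r = begin
    ∑[ π ∈ perms (suc n) ] χ (occ π + D y ≟ r) * χ (head π ≟ y)
      ≡⟨ ∑-cong (λ π → cong (_* χ (head π ≟ y)) (χ-+≟ (occ π) d≤r)) (perms (suc n)) ⟩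
    uHead (r ∸ D y) (suc n) y     ≡⟨ uPrepend-≡ r (suc n) v y refl d≤r ⟨
    uPrepend r (suc n) v y        ∎
  ... | no d≰r = begin
    ∑[ π ∈ perms (suc n) ] χ (occ π + D y ≟ r) * χ (head π ≟ y)
      ≡⟨ ∑-cong (λ π → cong (_* χ (head π ≟ y)) (χ-+≟-> (occ π) d≰r)) (perms (suc n)) ⟩
    ∑[ π ∈ perms (suc n) ] 0      ≡⟨ ∑-zero (perms (suc n)) ⟩
    0                             ≡⟨ uPrepend-> r (suc n) v y d≰r ⟨
    uPrepend r (suc n) v y        ∎

uHead-last : ∀ r m v → m ≤ v → v < suc (suc m) → uHead r (suc (suc m)) v ≡ u r (suc m)
uHead-last r m v m≤v v<2+m = begin
  uHead r (suc (suc m)) v                 ≡⟨ uHead-suc r m v v<2+m ⟩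
  ∑[ y < suc m ] uPrepend r (suc m) v y
    ≡⟨ ∑<-cong (suc m) (λ y _ → uPrepend-≡ r (suc m) v y (prependOcc-large (suc m) y (s≤s m≤v)) z≤n) ⟩
  ∑[ y < suc m ] uHead r (suc m) y        ≡⟨ u≡∑uHead r m ⟨
  u r (suc m)                             ∎

-- Raising the prepended value from v to suc v only affects the permutations
-- starting with v, which then gain no occurrence.
uHead-step : ∀ r m v → v < suc m →
  uHead r (suc (suc m)) (suc v) + uPrepend r (suc m) v v ≡ uHead r (suc (suc m)) v + uHead r (suc m) v
uHead-step r m v v<1+m = begin
  uHead r (suc (suc m)) (suc v) + uPrepend r (suc m) v v
    ≡⟨ cong (_+ uPrepend r (suc m) v v) (uHead-suc r m (suc v) (s≤s v<1+m)) ⟩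
  ∑< (suc m) (uPrepend r (suc m) (suc v)) + uPrepend r (suc m) v v
    ≡⟨ ∑<-differ-at (suc m) v _ _ v<1+m (λ y _ → uPrepend-suc r (suc m)) ⟩
  ∑< (suc m) (uPrepend r (suc m) v) + uPrepend r (suc m) (suc v) v
    ≡⟨ cong₂ _+_ (uHead-suc r m v (ℕ.m≤n⇒m≤1+n v<1+m))
                 (sym (uPrepend-≡ r (suc m) (suc v) v (prependOcc-> (suc m) {y = v} (ℕ.<-irrefl refl)) z≤n)) ⟨
  uHead r (suc (suc m)) v + uHead r (suc m) v ∎

-- Permutations with at most one occurrence

uPrepend1-far : ∀ n {v y} → v ≤ y → 3 + y ≤ n → uPrepend 1 n v y ≡ 0
uPrepend1-far n {v} {y} v≤y 3+y≤n =
  uPrepend-> 1 n v y (ℕ.<⇒≱ (subst (1 <_) (sym (prependOcc-≤ n v y v≤y)) (ℕ.m+n≤o⇒m≤o∸n 2 3+y≤n)))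

uPrepend1-next : ∀ m {v} → v ≤ m → uPrepend 1 (suc (suc m)) v m ≡ u 0 (suc m)
uPrepend1-next m {v} v≤m = begin
  uPrepend 1 (suc (suc m)) v m
    ≡⟨ uPrepend-≡ 1 (suc (suc m)) v m (trans (prependOcc-≤ (suc (suc m)) v m v≤m) (ℕ.m+n∸n≡m 1 m)) ℕ.≤-refl ⟩
  uHead 0 (suc (suc m)) m        ≡⟨ uHead-last 0 m m ℕ.≤-refl (ℕ.n≤1+n (suc m)) ⟩
  u 0 (suc m)                    ∎

u≤1 : ℕ → ℕ
u≤1 n = u 0 n + u 1 n

uHead1-zero : ∀ m → uHead 1 (suc (suc (suc m))) 0 ≡ u≤1 (suc m)
uHead1-zero m = begin
  uHead 1 (suc (suc (suc m))) 0               ≡⟨ uHead-suc 1 (suc m) 0 z<s ⟩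
  ∑< m f + f m + f (suc m)                    ≡⟨ cong₂ _+_ (cong₂ _+_ f-below (uPrepend1-next m z≤n)) f-last ⟩
  0 + u 0 (suc m) + uHead 1 (suc (suc m)) (suc m)
    ≡⟨ cong (u 0 (suc m) +_) (uHead-last 1 m (suc m) (ℕ.n≤1+n m) ℕ.≤-refl) ⟩
  u≤1 (suc m)                                 ∎
  where
  n = suc (suc m)
  f = uPrepend 1 n 0
  f-below : ∑< m f ≡ 0
  f-below = trans (∑<-cong m (λ y y<m → uPrepend1-far n z≤n (s≤s (s≤s y<m)))) (∑<-zero m)
  f-last : f (suc m) ≡ uHead 1 n (suc m)
  f-last = uPrepend-≡ 1 n 0 (suc m) (prependOcc-lastValue n 0 ℕ.≤-refl) z≤n

uHead1-step : ∀ m v → 2 + v ≤ m → uHead 1 (suc (suc m)) (suc v) ≡ uHead 1 (suc (suc m)) v + uHead 1 (suc m) v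
uHead1-step m v 2+v≤m = begin
  uHead 1 (suc (suc m)) (suc v)                                 ≡⟨ ℕ.+-identityʳ _ ⟨
  uHead 1 (suc (suc m)) (suc v) + 0                             ≡⟨ cong (uHead 1 (suc (suc m)) (suc v) +_) no-gain ⟨
  uHead 1 (suc (suc m)) (suc v) + uPrepend 1 (suc m) v v
    ≡⟨ uHead-step 1 m v (ℕ.≤-trans (ℕ.n≤1+n (suc v)) (ℕ.m≤n⇒m≤1+n 2+v≤m)) ⟩
  uHead 1 (suc (suc m)) v + uHead 1 (suc m) v                   ∎
  where
  no-gain : uPrepend 1 (suc m) v v ≡ 0
  no-gain = uPrepend1-far (suc m) ℕ.≤-refl (s≤s 2+v≤m)

uHead1-composed : ∀ v e → uHead 1 (suc (suc (suc (e + v)))) v ≡ composed (λ k → u≤1 (e + k)) (suc v)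
uHead1-composed zero    e = begin
  uHead 1 (suc (suc (suc (e + 0)))) 0        ≡⟨ cong (λ i → uHead 1 (suc (suc (suc i))) 0) (ℕ.+-identityʳ e) ⟩
  uHead 1 (suc (suc (suc e))) 0              ≡⟨ uHead1-zero e ⟩
  u≤1 (suc e)                                ≡⟨ cong u≤1 (ℕ.+-comm e 1) ⟨
  u≤1 (e + 1)                                ≡⟨ ℕ.+-identityʳ _ ⟨
  composed (λ k → u≤1 (e + k)) 1             ∎
uHead1-composed (suc v) e = begin
  uHead 1 (suc (suc (suc (e + suc v)))) (suc v)
    ≡⟨ cong (λ i → uHead 1 (suc (suc (suc i))) (suc v)) (ℕ.+-suc e v) ⟩
  uHead 1 (suc (suc (suc (suc (e + v))))) (suc v)
    ≡⟨ uHead1-step (suc (suc (e + v))) v (s≤s (s≤s (ℕ.m≤n+m v e))) ⟩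
  uHead 1 (suc (suc (suc (suc (e + v))))) v + uHead 1 (suc (suc (suc (e + v)))) v
    ≡⟨ cong₂ _+_ (uHead1-composed v (suc e)) (uHead1-composed v e) ⟩
  composed (λ k → u≤1 (suc e + k)) (suc v) + composed (λ k → u≤1 (e + k)) (suc v)
    ≡⟨ cong (_+ composed (λ k → u≤1 (e + k)) (suc v)) (composed-cong (λ k → cong u≤1 (ℕ.+-suc e k)) (suc v)) ⟨
  composed (λ k → u≤1 (e + suc k)) (suc v) + composed (λ k → u≤1 (e + k)) (suc v)
    ≡⟨ composed-suc (λ k → u≤1 (e + k)) v ⟨
  composed (λ k → u≤1 (e + k)) (suc (suc v)) ∎

u1-recurrence : ∀ n → u 1 (suc n) + u 0 n ≡ composed u≤1 n + u 1 n
u1-recurrence zero    = refl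
u1-recurrence (suc m) = begin
  u 1 (suc (suc m)) + u 0 (suc m)
    ≡⟨ cong₂ _+_ (uHead-last 1 (suc m) (suc m) ℕ.≤-refl (ℕ.m≤n⇒m≤1+n ℕ.≤-refl)) (uPrepend1-next m ℕ.≤-refl) ⟨
  uHead 1 (suc (suc (suc m))) (suc m) + uPrepend 1 (suc (suc m)) m m
    ≡⟨ uHead-step 1 (suc m) m (ℕ.m≤n⇒m≤1+n ℕ.≤-refl) ⟩
  uHead 1 (suc (suc (suc m))) m + uHead 1 (suc (suc m)) m
    ≡⟨ cong₂ _+_ (uHead1-composed m 0) (uHead-last 1 m m ℕ.≤-refl (ℕ.m≤n⇒m≤1+n ℕ.≤-refl)) ⟩
  composed u≤1 (suc m) + u 1 (suc m) ∎

m+n≡o+p⇒m≡p+[o-n] : ∀ (m n o p : ℤ) → m ℤ.+ n ≡ o ℤ.+ p → m ≡ p ℤ.+ (o ℤ.- n)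
m+n≡o+p⇒m≡p+[o-n] m n o p eq = begin
  m                      ≡⟨ cancel m n ⟩
  (m ℤ.+ n) ℤ.- n        ≡⟨ cong (ℤ._- n) eq ⟩
  (o ℤ.+ p) ℤ.- n        ≡⟨ regroup o p n ⟩
  p ℤ.+ (o ℤ.- n)        ∎
  where
  cancel : ∀ (x y : ℤ) → x ≡ (x ℤ.+ y) ℤ.- y
  cancel = solve-∀
  regroup : ∀ (x y z : ℤ) → (x ℤ.+ y) ℤ.- z ≡ y ℤ.+ (x ℤ.- z)
  regroup = solve-∀

U1-suc : ∀ n → U 1 (suc n) ≡ U 1 n ℤ.+ (((U 1 ∘ₚ x/1-x) ⊕ (U 0 ∘ₚ x/1-x)) ⊖ U 0) n
U1-suc n = begin
  ℤ.+ u 1 (suc n)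
    ≡⟨ m+n≡o+p⇒m≡p+[o-n] (ℤ.+ u 1 (suc n)) (ℤ.+ u 0 n) (ℤ.+ c₁ ℤ.+ ℤ.+ c₀) (ℤ.+ u 1 n) recurrence ⟩
  ℤ.+ u 1 n ℤ.+ ((ℤ.+ c₁ ℤ.+ ℤ.+ c₀) ℤ.- ℤ.+ u 0 n)
    ≡⟨ cong₂ (λ x y → ℤ.+ u 1 n ℤ.+ ((x ℤ.+ y) ℤ.- ℤ.+ u 0 n)) (∘ₚ-x/1-x (u 1) n) (∘ₚ-x/1-x (u 0) n) ⟨
  ℤ.+ u 1 n ℤ.+ (((U 1 ∘ₚ x/1-x) ⊕ (U 0 ∘ₚ x/1-x)) ⊖ U 0) n ∎
  where
  c₀ = composed (u 0) n
  c₁ = composed (u 1) n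
  recurrence : ℤ.+ u 1 (suc n) ℤ.+ ℤ.+ u 0 n ≡ (ℤ.+ c₁ ℤ.+ ℤ.+ c₀) ℤ.+ ℤ.+ u 1 n
  recurrence = begin
    ℤ.+ u 1 (suc n) ℤ.+ ℤ.+ u 0 n    ≡⟨ ℤ.pos-+ (u 1 (suc n)) (u 0 n) ⟨
    ℤ.+ (u 1 (suc n) + u 0 n)        ≡⟨ cong ℤ.+_ (u1-recurrence n) ⟩
    ℤ.+ (composed u≤1 n + u 1 n)     ≡⟨ cong (λ c → ℤ.+ (c + u 1 n)) (composed-+ (u 0) (u 1) n) ⟩
    ℤ.+ (c₀ + c₁ + u 1 n)            ≡⟨ cong (λ c → ℤ.+ (c + u 1 n)) (ℕ.+-comm c₀ c₁) ⟩
    ℤ.+ (c₁ + c₀ + u 1 n)            ≡⟨ ℤ.pos-+ (c₁ + c₀) (u 1 n) ⟩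
    ℤ.+ (c₁ + c₀) ℤ.+ ℤ.+ u 1 n      ≡⟨ cong (ℤ._+ ℤ.+ u 1 n) (ℤ.pos-+ c₁ c₀) ⟩
    (ℤ.+ c₁ ℤ.+ ℤ.+ c₀) ℤ.+ ℤ.+ u 1 n ∎

corollary1 : ∀ (n : ℕ) →
    U 1 n ≡ (x/1-x ⊛ (((U 1 ∘ₚ x/1-x) ⊕ (U 0 ∘ₚ x/1-x)) ⊖ U 0)) n
corollary1 zero    = refl
corollary1 (suc n) = begin
  U 1 (suc n)                  ≡⟨ U1-suc n ⟩
  U 1 n ℤ.+ H n                ≡⟨ cong (ℤ._+ H n) (corollary1 n) ⟩
  (x/1-x ⊛ H) n ℤ.+ H n        ≡⟨ x/1-x-⊛-suc H n ⟨
  (x/1-x ⊛ H) (suc n)          ∎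
  where
  H = ((U 1 ∘ₚ x/1-x) ⊕ (U 0 ∘ₚ x/1-x)) ⊖ U 0
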